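{- Let $n_1,n_2,m_1,m_2\in\mathbb{N}$ with $\gcd(n_1,n_2)=\gcd(m_1,m_2)=1$. If $f_1:\mathcal{D}(n_1)\to\mathcal{D}(m_1)$ and $f_2:\mathcal{D}(n_2)\to\mathcal{D}(m_2)$ are reducing functions, then the function $f_1f_2:\mathcal{D}(n_1n_2)\to\mathcal{D}(m_1m_2)$, defined by $(f_1f_2)(d_1d_2)=f_1(d_1)f_2(d_2)$ for $d_1\in\mathcal{D}(n_1)$, $d_2\in\mathcal{D}(n_2)$, is reducing.
   Context: For $n\in\mathbb{N}$, $\mathcal{D}(n)$ is the set of positive divisors of $n$; $\lambda(n)$ is the least prime factor of $n$ if $n\ge2$, and $\lambda(1)=1$. For $m,n\in\mathbb{N}$, a function $f:\mathcal{D}(n)\to\mathcal{D}(m)$ is reducing if for all $d,d'\in\mathcal{D}(n)$: (a) $f(d)\le d$; (b) $\frac{m/f(d)}{n/d}\le\min\left\{1,\frac{\lambda(m/f(d))}{\lambda(n/d)}\right\}$; (c) if $f(d)=2^if(d')$ for some $i\in\mathbb{Z}$, then $d=2^jd'$ for some $j\in\mathbb{Z}$. -}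

module Defs where

open import Data.Nat using (ℕ; _*_; _^_; _≤_)
open import Data.Nat.Divisibility using (_∣_)
open import Data.Nat.GCD using (gcd)
open import Data.Nat.Primality using (Prime)
open import Data.Product using (_×_; ∃₂)
open import Data.Sum using (_⊎_)
open import Relation.Binary.PropositionalEquality using (_≡_)

-- λ(n): the least prime factor of n (n ≥ 2), and λ(1) = 1, as a relation
-- "IsLeastPrimeFactor n p" meaning λ(n) = p (this determines p uniquely for n ≥ 1).
IsLeastPrimeFactor : ℕ → ℕ → Set
IsLeastPrimeFactor n p =
  (n ≡ 1 × p ≡ 1) ⊎
  (Prime p × p ∣ n × (∀ q → Prime q → q ∣ n → p ≤ q))

-- For positive x, y: "x = 2^i * y for some i ∈ ℤ", i.e. 2^j * x = 2^k * y for some j, k ∈ ℕ.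
Pow2Related : ℕ → ℕ → Set
Pow2Related x y = ∃₂ λ j k → 2 ^ j * x ≡ 2 ^ k * y

-- A function f : D(n) → D(m) is represented by f : ℕ → ℕ, of which only the values
-- on divisors of n matter; 'maps-into' says it sends D(n) into D(m).
record Reducing (n m : ℕ) (f : ℕ → ℕ) : Set where
  field
    maps-into : ∀ d → d ∣ n → f d ∣ m
    cond-a    : ∀ d → d ∣ n → f d ≤ d
    -- (b) with a = m / f(d) and b = n / d:
    --     a / b ≤ 1  and  a / b ≤ λ(a) / λ(b)   (cross-multiplied; a, b > 0)
    cond-b    : ∀ d a b → d ∣ n → f d * a ≡ m → d * b ≡ n →
                (a ≤ b) × (∀ p q → IsLeastPrimeFactor a p → IsLeastPrimeFactor b q →
                                   a * q ≤ p * b)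
    cond-c    : ∀ d d' → d ∣ n → d' ∣ n → Pow2Related (f d) (f d') → Pow2Related d d'

-- The product function f₁f₂ : D(n₁n₂) → D(m₁m₂), (f₁f₂)(d₁d₂) = f₁(d₁) f₂(d₂).
-- For gcd(n₁,n₂) = 1 every d ∣ n₁n₂ factors uniquely as d₁d₂ with d₁ = gcd(d,n₁) ∣ n₁
-- and d₂ = gcd(d,n₂) ∣ n₂.
prodFun : (n₁ n₂ : ℕ) → (ℕ → ℕ) → (ℕ → ℕ) → ℕ → ℕ
prodFun n₁ n₂ f₁ f₂ d = f₁ (gcd d n₁) * f₂ (gcd d n₂)

module Submission where

-- Since gcd(n₁,n₂) = 1, every d ∣ n₁n₂ is d₁d₂ with dᵢ = gcd(d,nᵢ), and the cofactors
-- a = m₁m₂/(f₁(d₁)f₂(d₂)) and b = n₁n₂/d split as a₁a₂ and b₁b₂ with the cofactors of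
-- the two factors. Condition (a) and a ≤ b multiply. For the λ-part, λ(a₁a₂) divides,
-- say, a₁ and is then λ(a₁), while λ(b₁b₂) ≤ λ(b₁); hence
-- a₁a₂·λ(b₁b₂) ≤ (a₁·λ(b₁))·a₂ ≤ λ(a₁)b₁·b₂.
-- For (c), one of m₁, m₂ is odd, say m₁; then no power of 2 can pass between the two
-- factors, so 2ʲf₁(d₁)f₂(d₂) = 2ᵏf₁(d₁')f₂(d₂') forces f₁(d₁) = f₁(d₁') and
-- 2ʲf₂(d₂) = 2ᵏf₂(d₂'), and (c) for f₁ and f₂ relates d₁, d₁' and d₂, d₂'.

open import Defs
open import Data.Nat.Base
open import Data.Nat.Properties
open import Data.Nat.Divisibility
open import Data.Nat.GCD
open import Data.Nat.Coprimality using (Coprime; coprime-divisor) renaming (sym to coprime-sym)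
open import Data.Nat.Primality
open import Algebra.Properties.CommutativeSemigroup *-commutativeSemigroup
  using (interchange; x∙yz≈y∙xz; xy∙z≈xz∙y)
open import Data.Product
open import Data.Sum using (inj₁; inj₂)
open import Relation.Nullary using (¬_; yes; no; contradiction)
open import Relation.Binary.PropositionalEquality

∣-nonZero : ∀ {a m} → .{{NonZero m}} → a ∣ m → NonZero a
∣-nonZero {zero}  a∣m = contradiction (0∣⇒≡0 a∣m) (≢-nonZero⁻¹ _)
∣-nonZero {suc a} _   = _

coprime-∣ : ∀ {m n x y} → gcd m n ≡ 1 → x ∣ m → y ∣ n → Coprime x y
coprime-∣ gcd≡1 x∣m y∣n (i∣x , i∣y) =
  ∣1⇒≡1 (subst (_ ∣_) gcd≡1 (gcd-greatest (∣-trans i∣x x∣m) (∣-trans i∣y y∣n)))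

coprime⇒*-∣ : ∀ {x y k} → Coprime x y → x ∣ k → y ∣ k → x * y ∣ k
coprime⇒*-∣ {x} {y} coprime (divides q refl) y∣qx =
  subst (x * y ∣_) (*-comm x q) (*-monoʳ-∣ x y∣q)
  where
  y∣q : y ∣ q
  y∣q = coprime-divisor (coprime-sym coprime) (subst (y ∣_) (*-comm q x) y∣qx)

gcd[d,n₁]*gcd[d,n₂]≡d : ∀ {n₁ n₂ d} → gcd n₁ n₂ ≡ 1 → d ∣ n₁ * n₂ → gcd d n₁ * gcd d n₂ ≡ d
gcd[d,n₁]*gcd[d,n₂]≡d {n₁} {n₂} {d} gcd≡1 d∣n₁n₂ = ∣-antisym
  (coprime⇒*-∣ (coprime-∣ gcd≡1 (gcd[m,n]∣n d n₁) (gcd[m,n]∣n d n₂))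
               (gcd[m,n]∣m d n₁) (gcd[m,n]∣m d n₂))
  (subst (d ∣_) gcd[n₁d₂,dd₂]≡d₁d₂ (gcd-greatest d∣n₁d₂ (m∣m*n (gcd d n₂))))
  where
  open ≡-Reasoning
  d∣n₁d₂ : d ∣ n₁ * gcd d n₂
  d∣n₁d₂ = subst (d ∣_) (trans (sym (c*gcd[m,n]≡gcd[cm,cn] n₁ n₂ d)) (cong (n₁ *_) (gcd-comm n₂ d)))
             (gcd-greatest d∣n₁n₂ (n∣m*n n₁))
  gcd[n₁d₂,dd₂]≡d₁d₂ : gcd (n₁ * gcd d n₂) (d * gcd d n₂) ≡ gcd d n₁ * gcd d n₂
  gcd[n₁d₂,dd₂]≡d₁d₂ = begin
    gcd (n₁ * gcd d n₂) (d * gcd d n₂) ≡⟨ cong₂ gcd (*-comm n₁ _) (*-comm d _) ⟩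
    gcd (gcd d n₂ * n₁) (gcd d n₂ * d) ≡⟨ sym (c*gcd[m,n]≡gcd[cm,cn] (gcd d n₂) n₁ d) ⟩
    gcd d n₂ * gcd n₁ d                ≡⟨ cong (gcd d n₂ *_) (gcd-comm n₁ d) ⟩
    gcd d n₂ * gcd d n₁                ≡⟨ *-comm (gcd d n₂) _ ⟩
    gcd d n₁ * gcd d n₂                ∎

cofactor-* : ∀ {x₁ x₂ M₁ M₂ c} → .{{NonZero M₁}} → .{{NonZero M₂}} → x₁ ∣ M₁ → x₂ ∣ M₂ →
             x₁ * x₂ * c ≡ M₁ * M₂ →
             ∃₂ λ c₁ c₂ → x₁ * c₁ ≡ M₁ × x₂ * c₂ ≡ M₂ × c ≡ c₁ * c₂
cofactor-* {x₁} {x₂} {c = c} x₁∣M₁@(divides c₁ refl) x₂∣M₂@(divides c₂ refl) eq =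
  c₁ , c₂ , *-comm x₁ c₁ , *-comm x₂ c₂ ,
  *-cancelˡ-≡ c (c₁ * c₂) (x₁ * x₂) {{m*n≢0 x₁ x₂ {{∣-nonZero x₁∣M₁}} {{∣-nonZero x₂∣M₂}}}}
    (trans eq (trans (interchange c₁ x₁ c₂ x₂) (*-comm (c₁ * c₂) (x₁ * x₂))))

PrimeDivisorsAtLeast : ℕ → ℕ → Set
PrimeDivisorsAtLeast n q = ∀ r → Prime r → r ∣ n → q ≤ r

LeastPrimeDivisor : ℕ → ℕ → Set
LeastPrimeDivisor n p = Prime p × p ∣ n × PrimeDivisorsAtLeast n p

prime⇒≥2 : ∀ {p} → Prime p → 2 ≤ p
prime⇒≥2 p-prime = nonTrivial⇒n>1 _ {{prime⇒nonTrivial p-prime}}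

primeDivisorsAtLeast-∣ : ∀ {m n q} → m ∣ n → PrimeDivisorsAtLeast n q → PrimeDivisorsAtLeast m q
primeDivisorsAtLeast-∣ m∣n n≥q r r-prime r∣m = n≥q r r-prime (∣-trans r∣m m∣n)

leastPrimeDivisor-∣ : ∀ {m n p} → m ∣ n → p ∣ m → LeastPrimeDivisor n p → LeastPrimeDivisor m p
leastPrimeDivisor-∣ m∣n p∣m (p-prime , _ , least) = p-prime , p∣m , primeDivisorsAtLeast-∣ m∣n least

rough⇒primeDivisorsAtLeast : ∀ {m n} → m Rough n → PrimeDivisorsAtLeast n m
rough⇒primeDivisorsAtLeast rough r r-prime r∣n =
  ≮⇒≥ λ r<m → rough (hasNonTrivialDivisor {{prime⇒nonTrivial r-prime}} r<m r∣n)

-- Trial division: m runs upwards from 2 and n stays m-rough, so the first divisor found is prime.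
leastPrimeDivisor-search : ∀ k m {n} → .{{NonTrivial m}} → m + k ≡ n → m Rough n →
                           ∃ (LeastPrimeDivisor n)
leastPrimeDivisor-search k m eq rough with m ∣? _
... | yes m∣n = m , rough∧∣⇒prime rough m∣n , m∣n , rough⇒primeDivisorsAtLeast rough
leastPrimeDivisor-search zero m eq rough | no m∤n =
  contradiction (subst (m ∣_) (trans (sym (+-identityʳ m)) eq) ∣-refl) m∤n
leastPrimeDivisor-search (suc k) m eq rough | no m∤n =
  leastPrimeDivisor-search k (suc m) {{n>1⇒nonTrivial (m<n⇒m<1+n (nonTrivial⇒n>1 m))}}
    (trans (sym (+-suc m k)) eq) (∤⇒rough-suc m∤n rough)

leastPrimeDivisor : ∀ n → .{{NonTrivial n}} → ∃ (LeastPrimeDivisor n)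
leastPrimeDivisor (2+ k) = leastPrimeDivisor-search k 2 refl 2-rough

isLeastPrimeFactor⇒primeDivisorsAtLeast : ∀ {n q} → IsLeastPrimeFactor n q → PrimeDivisorsAtLeast n q
isLeastPrimeFactor⇒primeDivisorsAtLeast (inj₁ (_ , refl))     r r-prime _ = ≤-trans (s≤s z≤n) (prime⇒≥2 r-prime)
isLeastPrimeFactor⇒primeDivisorsAtLeast (inj₂ (_ , _ , least)) = least

isLeastPrimeFactor⇒≤ : ∀ {n q} → .{{NonZero n}} → IsLeastPrimeFactor n q → q ≤ n
isLeastPrimeFactor⇒≤ (inj₁ (refl , refl)) = ≤-refl
isLeastPrimeFactor⇒≤ (inj₂ (_ , q∣n , _)) = ∣⇒≤ q∣n

LambdaBound : ℕ → ℕ → Set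
LambdaBound a b = ∀ p q → IsLeastPrimeFactor a p → IsLeastPrimeFactor b q → a * q ≤ p * b

lambdaBound⇒≤ : ∀ {a b p q} → a ≤ b → LambdaBound a b →
                LeastPrimeDivisor a p → PrimeDivisorsAtLeast b q → a * q ≤ p * b
lambdaBound⇒≤ {zero} _ _ _ _ = z≤n
lambdaBound⇒≤ {suc a} {1} a≤1 _ (p-prime , p∣a , _) _ =
  contradiction (≤-trans (prime⇒≥2 p-prime) (≤-trans (∣⇒≤ p∣a) a≤1)) (λ { (s≤s ()) })
lambdaBound⇒≤ {suc a} {b@(2+ _)} {p} a≤b λ-bound least-a b≥q
  with q' , least-b@(q'-prime , q'∣b , _) ← leastPrimeDivisor b =
  ≤-trans (*-monoʳ-≤ (suc a) (b≥q q' q'-prime q'∣b)) (λ-bound p q' (inj₂ least-a) (inj₂ least-b))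

lambdaBound-*ˡ : ∀ {a₁ a₂ b₁ b₂ p q} → a₁ ≤ b₁ → a₂ ≤ b₂ → LambdaBound a₁ b₁ →
                 LeastPrimeDivisor a₁ p → PrimeDivisorsAtLeast b₁ q →
                 a₁ * a₂ * q ≤ p * (b₁ * b₂)
lambdaBound-*ˡ {a₁} {a₂} {b₁} {b₂} {p} {q} a₁≤b₁ a₂≤b₂ λ₁ least₁ b₁≥q = begin
  a₁ * a₂ * q   ≡⟨ xy∙z≈xz∙y a₁ a₂ q ⟩
  a₁ * q * a₂   ≤⟨ *-mono-≤ (lambdaBound⇒≤ a₁≤b₁ λ₁ least₁ b₁≥q) a₂≤b₂ ⟩
  p * b₁ * b₂   ≡⟨ *-assoc p b₁ b₂ ⟩
  p * (b₁ * b₂) ∎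
  where open ≤-Reasoning

lambdaBound-* : ∀ {a₁ a₂ b₁ b₂} → a₁ ≤ b₁ → a₂ ≤ b₂ → LambdaBound a₁ b₁ → LambdaBound a₂ b₂ →
                LambdaBound (a₁ * a₂) (b₁ * b₂)
lambdaBound-* {a₁} {a₂} {b₁} {b₂} a₁≤b₁ a₂≤b₂ _ _ p q (inj₁ (a≡1 , refl)) least-b = begin
  a₁ * a₂ * q   ≡⟨ cong (_* q) a≡1 ⟩
  1 * q         ≤⟨ *-monoʳ-≤ 1 (isLeastPrimeFactor⇒≤ {{>-nonZero 0<b}} least-b) ⟩
  1 * (b₁ * b₂) ∎
  where
  open ≤-Reasoning
  0<b : 0 < b₁ * b₂
  0<b = subst (_≤ b₁ * b₂) a≡1 (*-mono-≤ a₁≤b₁ a₂≤b₂)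
lambdaBound-* {a₁} {a₂} {b₁} {b₂} a₁≤b₁ a₂≤b₂ λ₁ λ₂ p q (inj₂ least@(p-prime , p∣a , _)) least-b
  with euclidsLemma a₁ a₂ p-prime p∣a
... | inj₁ p∣a₁ =
  lambdaBound-*ˡ a₁≤b₁ a₂≤b₂ λ₁ (leastPrimeDivisor-∣ (m∣m*n a₂) p∣a₁ least)
    (primeDivisorsAtLeast-∣ (m∣m*n b₂) (isLeastPrimeFactor⇒primeDivisorsAtLeast least-b))
... | inj₂ p∣a₂ = subst₂ (λ a b → a * q ≤ p * b) (*-comm a₂ a₁) (*-comm b₂ b₁)
  (lambdaBound-*ˡ a₂≤b₂ a₁≤b₁ λ₂ (leastPrimeDivisor-∣ (n∣m*n a₁) p∣a₂ least)
    (primeDivisorsAtLeast-∣ (n∣m*n b₁) (isLeastPrimeFactor⇒primeDivisorsAtLeast least-b)))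

pow2Related-* : ∀ {x x' y y'} → Pow2Related x x' → Pow2Related y y' → Pow2Related (x * y) (x' * y')
pow2Related-* {x} {x'} {y} {y'} (i , i' , 2ⁱx≡2ⁱ'x') (j , j' , 2ʲy≡2ʲ'y') =
  i + j , i' + j' ,
  trans (split-2^ i j x y) (trans (cong₂ _*_ 2ⁱx≡2ⁱ'x' 2ʲy≡2ʲ'y') (sym (split-2^ i' j' x' y')))
  where
  split-2^ : ∀ i j x y → 2 ^ (i + j) * (x * y) ≡ 2 ^ i * x * (2 ^ j * y)
  split-2^ i j x y = trans (cong (_* (x * y)) (^-distribˡ-+-* 2 i j)) (interchange (2 ^ i) (2 ^ j) x y)

¬2∣⇒coprime-2 : ∀ {u} → ¬ 2 ∣ u → Coprime u 2
¬2∣⇒coprime-2 2∤u (i∣u , i∣2) with prime⇒irreducible prime[2] i∣2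
... | inj₁ i≡1  = i≡1
... | inj₂ refl = contradiction i∣u 2∤u

coprime-2^-divisor : ∀ k {u w} → Coprime u 2 → u ∣ 2 ^ k * w → u ∣ w
coprime-2^-divisor zero    {u} {w} _       u∣w      = subst (u ∣_) (+-identityʳ w) u∣w
coprime-2^-divisor (suc k) {u} {w} coprime u∣2^k+1w =
  coprime-2^-divisor k coprime (coprime-divisor coprime (subst (u ∣_) (*-assoc 2 (2 ^ k) w) u∣2^k+1w))

odd-factor-∣ : ∀ {u v u' v' j k} → ¬ 2 ∣ u → Coprime u v' →
               2 ^ j * (u * v) ≡ 2 ^ k * (u' * v') → u ∣ u'
odd-factor-∣ {u} {v} {u'} {v'} {j} {k} 2∤u coprime eq =
  coprime-divisor coprime (coprime-2^-divisor k (¬2∣⇒coprime-2 2∤u) u∣2^k*v'u')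
  where
  u∣2^k*v'u' : u ∣ 2 ^ k * (v' * u')
  u∣2^k*v'u' = subst (u ∣_) (trans eq (cong (2 ^ k *_) (*-comm u' v')))
                 (∣n⇒∣m*n (2 ^ j) (∣m⇒∣m*n v ∣-refl))

odd-factor-cancel : ∀ {u v u' v' j k} → .{{NonZero u}} → ¬ 2 ∣ u → ¬ 2 ∣ u' →
                    Coprime u v' → Coprime u' v → 2 ^ j * (u * v) ≡ 2 ^ k * (u' * v') →
                    u ≡ u' × 2 ^ j * v ≡ 2 ^ k * v'
odd-factor-cancel {u} {v} {u'} {v'} {j} {k} 2∤u 2∤u' coprime coprime' eq
  with refl ← ∣-antisym (odd-factor-∣ {j = j} {k} 2∤u coprime eq)
                        (odd-factor-∣ {j = k} {j} 2∤u' coprime' (sym eq)) =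
  refl , *-cancelˡ-≡ _ _ u (trans (x∙yz≈y∙xz u (2 ^ j) v) (trans eq (sym (x∙yz≈y∙xz u (2 ^ k) v'))))

pow2Related-split-odd : ∀ {m₁ m₂ u u' v v'} → .{{NonZero m₁}} → ¬ 2 ∣ m₁ → gcd m₁ m₂ ≡ 1 →
                        u ∣ m₁ → u' ∣ m₁ → v ∣ m₂ → v' ∣ m₂ → Pow2Related (u * v) (u' * v') →
                        Pow2Related u u' × Pow2Related v v'
pow2Related-split-odd 2∤m₁ gcd≡1 u∣m₁ u'∣m₁ v∣m₂ v'∣m₂ (j , k , eq)
  with refl , 2ʲv≡2ᵏv' ← odd-factor-cancel {j = j} {k} {{∣-nonZero u∣m₁}}
                           (λ 2∣u → 2∤m₁ (∣-trans 2∣u u∣m₁)) (λ 2∣u' → 2∤m₁ (∣-trans 2∣u' u'∣m₁))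
                           (coprime-∣ gcd≡1 u∣m₁ v'∣m₂) (coprime-∣ gcd≡1 u'∣m₁ v∣m₂) eq =
  (0 , 0 , refl) , (j , k , 2ʲv≡2ᵏv')

pow2Related-split : ∀ {m₁ m₂ u u' v v'} → .{{NonZero m₁}} → .{{NonZero m₂}} → gcd m₁ m₂ ≡ 1 →
                    u ∣ m₁ → u' ∣ m₁ → v ∣ m₂ → v' ∣ m₂ → Pow2Related (u * v) (u' * v') →
                    Pow2Related u u' × Pow2Related v v'
pow2Related-split {m₁} {m₂} {u} {u'} {v} {v'} gcd≡1 u∣m₁ u'∣m₁ v∣m₂ v'∣m₂ rel with 2 ∣? m₁
... | no 2∤m₁  = pow2Related-split-odd 2∤m₁ gcd≡1 u∣m₁ u'∣m₁ v∣m₂ v'∣m₂ rel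
... | yes 2∣m₁ = swap (pow2Related-split-odd 2∤m₂ (trans (gcd-comm m₂ m₁) gcd≡1) v∣m₂ v'∣m₂ u∣m₁ u'∣m₁
                   (subst₂ Pow2Related (*-comm u v) (*-comm u' v') rel))
  where
  2∤m₂ : ¬ 2 ∣ m₂
  2∤m₂ 2∣m₂ = contradiction (∣1⇒≡1 (subst (2 ∣_) gcd≡1 (gcd-greatest 2∣m₁ 2∣m₂))) λ ()

module _ {n₁ n₂ m₁ m₂ : ℕ} {f₁ f₂ : ℕ → ℕ}
         .{{_ : NonZero n₁}} .{{_ : NonZero n₂}} .{{_ : NonZero m₁}} .{{_ : NonZero m₂}}
         (gcd[n]≡1 : gcd n₁ n₂ ≡ 1) (gcd[m]≡1 : gcd m₁ m₂ ≡ 1)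
         (R₁ : Reducing n₁ m₁ f₁) (R₂ : Reducing n₂ m₂ f₂) where

  private
    module R₁ = Reducing R₁
    module R₂ = Reducing R₂

    d₁∣n₁ : ∀ d → gcd d n₁ ∣ n₁
    d₁∣n₁ d = gcd[m,n]∣n d n₁

    d₂∣n₂ : ∀ d → gcd d n₂ ∣ n₂
    d₂∣n₂ d = gcd[m,n]∣n d n₂

    f₁d₁∣m₁ : ∀ d → f₁ (gcd d n₁) ∣ m₁
    f₁d₁∣m₁ d = R₁.maps-into _ (d₁∣n₁ d)

    f₂d₂∣m₂ : ∀ d → f₂ (gcd d n₂) ∣ m₂
    f₂d₂∣m₂ d = R₂.maps-into _ (d₂∣n₂ d)

    d₁*d₂≡d : ∀ {d} → d ∣ n₁ * n₂ → gcd d n₁ * gcd d n₂ ≡ d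
    d₁*d₂≡d = gcd[d,n₁]*gcd[d,n₂]≡d gcd[n]≡1

  prodFun-cond-b : ∀ d a b → d ∣ n₁ * n₂ → prodFun n₁ n₂ f₁ f₂ d * a ≡ m₁ * m₂ →
                   d * b ≡ n₁ * n₂ → a ≤ b × LambdaBound a b
  prodFun-cond-b d a b d∣n fd*a≡m d*b≡n
    with a₁ , a₂ , fd₁*a₁≡m₁ , fd₂*a₂≡m₂ , refl ← cofactor-* (f₁d₁∣m₁ d) (f₂d₂∣m₂ d) fd*a≡m
       | b₁ , b₂ , d₁*b₁≡n₁ , d₂*b₂≡n₂ , refl ← cofactor-* (d₁∣n₁ d) (d₂∣n₂ d)
                                                   (subst (λ x → x * b ≡ _) (sym (d₁*d₂≡d d∣n)) d*b≡n) =
    let a₁≤b₁ , λ₁ = R₁.cond-b _ a₁ b₁ (d₁∣n₁ d) fd₁*a₁≡m₁ d₁*b₁≡n₁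
        a₂≤b₂ , λ₂ = R₂.cond-b _ a₂ b₂ (d₂∣n₂ d) fd₂*a₂≡m₂ d₂*b₂≡n₂
    in *-mono-≤ a₁≤b₁ a₂≤b₂ , lambdaBound-* a₁≤b₁ a₂≤b₂ λ₁ λ₂

  prodFun-cond-c : ∀ d d' → d ∣ n₁ * n₂ → d' ∣ n₁ * n₂ →
                   Pow2Related (prodFun n₁ n₂ f₁ f₂ d) (prodFun n₁ n₂ f₁ f₂ d') → Pow2Related d d'
  prodFun-cond-c d d' d∣n d'∣n rel =
    let rel₁ , rel₂ = pow2Related-split gcd[m]≡1 (f₁d₁∣m₁ d) (f₁d₁∣m₁ d') (f₂d₂∣m₂ d) (f₂d₂∣m₂ d') rel
    in subst₂ Pow2Related (d₁*d₂≡d d∣n) (d₁*d₂≡d d'∣n)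
         (pow2Related-* (R₁.cond-c _ _ (d₁∣n₁ d) (d₁∣n₁ d') rel₁)
                        (R₂.cond-c _ _ (d₂∣n₂ d) (d₂∣n₂ d') rel₂))

  prodFun-reducing : Reducing (n₁ * n₂) (m₁ * m₂) (prodFun n₁ n₂ f₁ f₂)
  prodFun-reducing = record
    { maps-into = λ d _ → *-pres-∣ (f₁d₁∣m₁ d) (f₂d₂∣m₂ d)
    ; cond-a    = λ d d∣n → subst (prodFun n₁ n₂ f₁ f₂ d ≤_) (d₁*d₂≡d d∣n)
                              (*-mono-≤ (R₁.cond-a _ (d₁∣n₁ d)) (R₂.cond-a _ (d₂∣n₂ d)))
    ; cond-b    = prodFun-cond-b
    ; cond-c    = prodFun-cond-c
    }

lemma3p6 : (n₁ n₂ m₁ m₂ : ℕ) → NonZero n₁ → NonZero n₂ → NonZero m₁ → NonZero m₂ →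
           gcd n₁ n₂ ≡ 1 → gcd m₁ m₂ ≡ 1 →
           (f₁ f₂ : ℕ → ℕ) → Reducing n₁ m₁ f₁ → Reducing n₂ m₂ f₂ →
           Reducing (n₁ * n₂) (m₁ * m₂) (prodFun n₁ n₂ f₁ f₂)
lemma3p6 _ _ _ _ n₁≢0 n₂≢0 m₁≢0 m₂≢0 gcd[n]≡1 gcd[m]≡1 _ _ R₁ R₂ =
  prodFun-reducing {{n₁≢0}} {{n₂≢0}} {{m₁≢0}} {{m₂≢0}} gcd[n]≡1 gcd[m]≡1 R₁ R₂
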